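{- Let $\psi:A^*\to A^*$ be a $2$-uniform substitution and let $\beta\in A^{\mathbb{Z}}$ be a two-sided periodic point of $\psi$ of period $1$. Then $\mathrm{rep}_\beta=\mathrm{rep}_{2c}$, i.e. the Dumont--Thomas complement numeration system associated with $\beta$ is the two's complement numeration system.
   Context: $A$ is a finite alphabet, $\varepsilon$ the empty word, $|w|$ the length, $w[i]$ the $i$-th letter (from $0$). A substitution $\psi$ is $2$-uniform if $|\psi(a)|=2$ for every $a\in A$ (so every letter is growing). $\psi$ acts on $u\in A^{\mathbb{Z}}$ by $\psi(\cdots u_{ -1}|u_0\cdots)=\cdots\psi(u_{ -2})\psi(u_{ -1})|\psi(u_0)\psi(u_1)\cdots$ ($|$ separating positions $-1$ and $0$); $u$ is a periodic point of period $p$ if $p$ is the least integer $\ge1$ with $\psi^p(u)=u$. A sequence $(m_i,a_i)_{i=0,\dots,k}$ in $A^*\times A$ is $x$-admissible if $m_{i-1}a_{i-1}$ is a prefix of $\psi(a_i)$ for $1\le i\le k$ and $m_ka_k$ is a prefix of $\psi(x)$. Here $\mathcal{D}=\{0,1\}$, $\odot$ denotes concatenation. Dumont--Thomas complement system for a periodic point $u$ of period $p$ (with growing seed): for $n\ge1$ there are a unique $k$ divisible by $p$ and a unique $u_0$-admissible $(m_i,a_i)_{i=0,\dots,k-1}$ with $m_{k-1}\cdots m_{k-p}\ne\varepsilon$ and $u_0\cdots u_{n-1}=\psi^{k-1}(m_{k-1})\cdots\psi^0(m_0)$; for $n\le-2$ there are a unique $k$ divisible by $p$ and a unique $u_{ -1}$-admissible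 $(m_i,a_i)_{i=0,\dots,k-1}$ with $\psi^{p-1}(m_{k-1})\cdots\psi^0(m_{k-p})a_{k-p}\ne\psi^p(u_{ -1})$ and $u_{ -|\psi^k(u_{ -1})|}\cdots u_{n-1}=\psi^{k-1}(m_{k-1})\cdots\psi^0(m_0)$. Then $\mathrm{rep}_u(n)=0\odot|m_{k-1}|\odot\cdots\odot|m_0|$ ($n\ge1$), $\mathrm{rep}_u(0)=0$, $\mathrm{rep}_u(-1)=1$, $\mathrm{rep}_u(n)=1\odot|m_{k-1}|\odot\cdots\odot|m_0|$ ($n\le-2$). Two's complement: for $w=w_{k-1}w_{k-2}\cdots w_0\in\{0,1\}^k$, $\mathrm{val}_{2c}(w)=\sum_{i=0}^{k-1}w_i2^i-w_{k-1}2^k$; for every $n\in\mathbb{Z}$ there is a unique $w\in\{0,1\}^+\setminus(00\{0,1\}^*\cup11\{0,1\}^*)$ with $\mathrm{val}_{2c}(w)=n$, denoted $\mathrm{rep}_{2c}(n)$. -}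

module Defs where

open import Data.Nat using (ℕ; zero; suc; _*_; _^_; _≤_; _<_)
import Data.Nat as N
open import Data.Integer as Z using (ℤ; +_; -[1+_]; -_)
open import Data.Fin using (Fin)
open import Data.List using (List; []; _∷_; _++_; length; concatMap)
open import Data.List.Relation.Unary.All using (All)
open import Data.Product using (Σ; ∃; _×_; _,_)
open import Relation.Binary.PropositionalEquality using (_≡_; _≢_)
open import Relation.Nullary using (¬_)

Subst : ℕ → Set
Subst s = Fin s → List (Fin s)

TwoUniform : ∀ {s} → Subst s → Set
TwoUniform ψ = ∀ a → length (ψ a) ≡ 2

applyW : ∀ {s} → Subst s → List (Fin s) → List (Fin s)
applyW ψ w = concatMap ψ w

iterW : ∀ {s} → Subst s → ℕ → List (Fin s) → List (Fin s)
iterW ψ zero w = w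
iterW ψ (suc j) w = applyW ψ (iterW ψ j w)

BiSeq : ℕ → Set
BiSeq s = ℤ → Fin s

seg : ∀ {s} → BiSeq s → ℤ → ℕ → List (Fin s)
seg u t zero = []
seg u t (suc ℓ) = u t ∷ seg u (t Z.+ + 1) ℓ

-- For an L-uniform substitution σ, σ(u) = u on A^ℤ means exactly that the
-- block σ(u_i) sits at positions L·i, ..., L·i + L - 1 for every i ∈ ℤ
-- (σ(u_0) starts at position 0, σ(u_{-1}) ends at position -1).
FixedByUniform : ∀ {s} → (Fin s → List (Fin s)) → ℕ → BiSeq s → Set
FixedByUniform σ L u = ∀ (i : ℤ) → σ (u i) ≡ seg u ((+ L) Z.* i) L

-- ψ^q(u) = u, for 2-uniform ψ (ψ^q is 2^q-uniform)
FixedByPow : ∀ {s} → Subst s → ℕ → BiSeq s → Set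
FixedByPow ψ q u = FixedByUniform (λ a → iterW ψ q (a ∷ [])) (2 ^ q) u

IsPeriodicPoint : ∀ {s} → Subst s → BiSeq s → ℕ → Set
IsPeriodicPoint ψ u p =
  (1 ≤ p) × FixedByPow ψ p u × (∀ q → 1 ≤ q → q < p → ¬ FixedByPow ψ q u)

Prefix : ∀ {s} → List (Fin s) → List (Fin s) → Set
Prefix x y = ∃ λ r → x ++ r ≡ y

Admissible : ∀ {s} → Subst s → Fin s → ℕ → (ℕ → List (Fin s)) → (ℕ → Fin s) → Set
Admissible ψ x k m a =
  (∀ i → suc i < k → Prefix (m i ++ (a i ∷ [])) (ψ (a (suc i)))) ×
  (∀ i → suc i ≡ k → Prefix (m i ++ (a i ∷ [])) (ψ x))

conc : ∀ {s} → Subst s → (ℕ → List (Fin s)) → ℕ → List (Fin s)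
conc ψ m zero = []
conc ψ m (suc k) = iterW ψ k (m k) ++ conc ψ m k

catDesc : ∀ {s} → (ℕ → List (Fin s)) → ℕ → List (Fin s)
catDesc m zero = []
catDesc m (suc k) = m k ++ catDesc m k

digits : ∀ {s} → (ℕ → List (Fin s)) → ℕ → List ℕ
digits m zero = []
digits m (suc k) = length (m k) ∷ digits m k

-- Dumont–Thomas complement representation of u (period p), as a relation:
-- RepDT ψ u p n w  means  rep_u(n) = w.
-- k ranges over positive multiples of p: k = p·(j+1), so k - p = p·j.
RepDT : ∀ {s} → Subst s → BiSeq s → ℕ → ℤ → List ℕ → Set
RepDT ψ u p (+ zero) w = w ≡ 0 ∷ []
RepDT ψ u p -[1+ zero ] w = w ≡ 1 ∷ []
RepDT {s} ψ u p (+ suc n) w =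
  ∃ λ (j : ℕ) → Σ (ℕ → List (Fin s)) λ m → Σ (ℕ → Fin s) λ a →
    Admissible ψ (u (+ 0)) (p * suc j) m a ×
    catDesc (λ i → m (p * j N.+ i)) p ≢ [] ×
    seg u (+ 0) (suc n) ≡ conc ψ m (p * suc j) ×
    w ≡ 0 ∷ digits m (p * suc j)
RepDT {s} ψ u p n@(-[1+ suc _ ]) w =
  ∃ λ (j : ℕ) → Σ (ℕ → List (Fin s)) λ m → Σ (ℕ → Fin s) λ a →
    Admissible ψ (u -[1+ 0 ]) (p * suc j) m a ×
    conc ψ (λ i → m (p * j N.+ i)) p ++ (a (p * j) ∷ [])
      ≢ iterW ψ p (u -[1+ 0 ] ∷ []) ×
    (∃ λ (ℓ : ℕ) →
      (- (+ length (iterW ψ (p * suc j) (u -[1+ 0 ] ∷ []))) Z.+ + ℓ ≡ n) ×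
      seg u (- (+ length (iterW ψ (p * suc j) (u -[1+ 0 ] ∷ [])))) ℓ
        ≡ conc ψ m (p * suc j)) ×
    w ≡ 1 ∷ digits m (p * suc j)

-- value of a digit word w_{k-1} ⋯ w_0 (most significant first) in base 2
valNat : List ℕ → ℕ
valNat [] = 0
valNat (d ∷ ds) = d * 2 ^ length ds N.+ valNat ds

val2c : List ℕ → ℤ
val2c [] = + 0
val2c (d ∷ ds) = + valNat (d ∷ ds) Z.- + (d * 2 ^ suc (length ds))

Rep2c : ℤ → List ℕ → Set
Rep2c n w =
  All (_≤ 1) w × w ≢ [] ×
  (∀ r → w ≢ 0 ∷ 0 ∷ r) × (∀ r → w ≢ 1 ∷ 1 ∷ r) ×
  val2c w ≡ n

{-# OPTIONS --safe #-}
-- Since ψ is 2-uniform and ψ(β) = β, the image ψ(β_i) is the factor β_{2i} β_{2i+1}.  Hence every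
-- block m_i of an admissible sequence is a proper prefix of a word of length 2, so the digits
-- |m_i| are bits, and the factor ψ^{k-1}(m_{k-1}) ⋯ ψ^0(m_0) has length equal to their binary
-- value.  Conversely, every bit string is realised: going up from the least significant bit, a
-- bit r sends the letter β_P to β_{2P+r} and contributes the block β_{2P} ⋯ β_{2P+r-1} of length r.
-- The side conditions of the Dumont–Thomas system say that the top digit is 1 for n ≥ 1 and 0
-- for n ≤ -2, which are exactly the canonical two's complement words 0 1 ⋯ and 1 0 ⋯.
module Submission where

open import Defs
open import Data.Nat.Base as ℕ using (ℕ; zero; suc; _≤_; _<_; z≤n; s≤s; _^_)
import Data.Nat.Properties as ℕₚ
import Data.Nat.Tactic.RingSolver as ℕSolver
open import Data.Integer.Base as ℤ using (ℤ; +_; -[1+_]; -_; _⊖_)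
import Data.Integer.Properties as ℤₚ
import Data.Integer.Tactic.RingSolver as ℤSolver
open import Data.List.Base using (List; []; _∷_; _++_; _∷ʳ_; length; reverse)
import Data.List.Properties as Listₚ
open import Data.List.Relation.Unary.All using (All; []; _∷_)
open import Data.List.Relation.Unary.All.Properties using (∷ʳ⁺)
open import Data.Product.Base using (Σ; ∃; _×_; _,_; proj₂)
open import Data.Sum.Base using (_⊎_; inj₁; inj₂; [_,_]′)
open import Data.Fin.Base using (Fin)
open import Data.Empty using (⊥-elim)
open import Function.Base using (_∘_; id)
open import Function.Bundles using (_⇔_; mk⇔; Equivalence)
import Function.Properties.Equivalence as ⇔
open import Relation.Binary.PropositionalEquality

open Equivalence using (to; from)

length-∷ʳ : ∀ {A : Set} (xs : List A) x → length (xs ∷ʳ x) ≡ suc (length xs)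
length-∷ʳ xs x = trans (Listₚ.length-++ xs) (ℕₚ.+-comm (length xs) 1)

length≤1 : ∀ {A : Set} {xs : List A} → length xs ≤ 1 → xs ≡ [] ⊎ length xs ≡ 1
length≤1 {xs = []}          _        = inj₁ refl
length≤1 {xs = _ ∷ []}      _        = inj₂ refl
length≤1 {xs = _ ∷ _ ∷ _}   (s≤s ())

All-reverse : ∀ {A : Set} {P : A → Set} {xs} → All P xs → All P (reverse xs)
All-reverse {xs = []}     []       = []
All-reverse {xs = x ∷ xs} (p ∷ ps) =
  subst (All _) (sym (Listₚ.unfold-reverse x xs)) (∷ʳ⁺ (All-reverse ps) p)

module _ {s : ℕ} where

  prefix-length≤ : {xs ys : List (Fin s)} → Prefix xs ys → length xs ≤ length ys
  prefix-length≤ {xs} (_ , refl) = Listₚ.length-++-≤ˡ xs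

  prefix-length≡ : {xs ys : List (Fin s)} → Prefix xs ys → length xs ≡ length ys → xs ≡ ys
  prefix-length≡ {xs} ([]    , refl) _ = sym (Listₚ.++-identityʳ xs)
  prefix-length≡ {xs} (y ∷ r , refl) e =
    ⊥-elim (ℕₚ.m+1+n≢m (length xs) (trans (sym (Listₚ.length-++ xs)) (sym e)))

valNat-∷ʳ : ∀ ds d → valNat (ds ∷ʳ d) ≡ 2 ℕ.* valNat ds ℕ.+ d
valNat-∷ʳ []       d = trans (ℕₚ.+-identityʳ (d ℕ.* 1)) (ℕₚ.*-identityʳ d)
valNat-∷ʳ (e ∷ ds) d = begin
  e ℕ.* 2 ^ length (ds ∷ʳ d) ℕ.+ valNat (ds ∷ʳ d)
    ≡⟨ cong₂ (λ k v → e ℕ.* 2 ^ k ℕ.+ v) (length-∷ʳ ds d) (valNat-∷ʳ ds d) ⟩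
  e ℕ.* (2 ℕ.* 2 ^ length ds) ℕ.+ (2 ℕ.* valNat ds ℕ.+ d)
    ≡⟨ shift e (2 ^ length ds) (valNat ds) d ⟩
  2 ℕ.* (e ℕ.* 2 ^ length ds ℕ.+ valNat ds) ℕ.+ d ∎
  where
  open ≡-Reasoning
  shift : ∀ e p v d → e ℕ.* (2 ℕ.* p) ℕ.+ (2 ℕ.* v ℕ.+ d) ≡ 2 ℕ.* (e ℕ.* p ℕ.+ v) ℕ.+ d
  shift = ℕSolver.solve-∀

valNat-reverse-∷ : ∀ d ds → valNat (reverse (d ∷ ds)) ≡ 2 ℕ.* valNat (reverse ds) ℕ.+ d
valNat-reverse-∷ d ds =
  trans (cong valNat (Listₚ.unfold-reverse d ds)) (valNat-∷ʳ (reverse ds) d)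

valNat<2^length : ∀ {ds} → All (_≤ 1) ds → valNat ds < 2 ^ length ds
valNat<2^length []                   = s≤s z≤n
valNat<2^length {d ∷ ds} (d≤1 ∷ ds≤1) = begin-strict
  d ℕ.* p ℕ.+ valNat ds  <⟨ ℕₚ.+-monoʳ-< (d ℕ.* p) (valNat<2^length ds≤1) ⟩
  d ℕ.* p ℕ.+ p          ≤⟨ ℕₚ.+-monoˡ-≤ p (ℕₚ.*-monoˡ-≤ p d≤1) ⟩
  1 ℕ.* p ℕ.+ p          ≡⟨ ℕₚ.+-comm (1 ℕ.* p) p ⟩
  2 ℕ.* p                ∎
  where
  open ℕₚ.≤-Reasoning
  p = 2 ^ length ds

valNat-1∷-nonZero : ∀ ds → ∃ λ n → valNat (1 ∷ ds) ≡ suc n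
valNat-1∷-nonZero ds = ℕ.pred v , sym (ℕₚ.suc-pred v {{ℕ.>-nonZero v>0}})
  where
  v = valNat (1 ∷ ds)
  v>0 : 0 < v
  v>0 = ℕₚ.≤-trans (ℕₚ.m^n>0 2 (length ds))
          (ℕₚ.≤-trans (ℕₚ.≤-reflexive (sym (ℕₚ.*-identityˡ _))) (ℕₚ.m≤m+n _ (valNat ds)))

val2c-0∷ : ∀ ds → val2c (0 ∷ ds) ≡ + valNat ds
val2c-0∷ ds = cong +_ (ℕₚ.+-identityʳ (valNat ds))

val2c-1∷ : ∀ ds → val2c (1 ∷ ds) ≡ valNat ds ⊖ 2 ^ length ds
val2c-1∷ ds = begin
  val2c (1 ∷ ds)                       ≡⟨ ℤₚ.[+m]-[+n]≡m⊖n (1 ℕ.* p ℕ.+ v) (1 ℕ.* (2 ℕ.* p)) ⟩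
  (1 ℕ.* p ℕ.+ v) ⊖ (1 ℕ.* (2 ℕ.* p))  ≡⟨ cong₂ _⊖_ (cong (ℕ._+ v) (ℕₚ.*-identityˡ p))
                                                     (trans (ℕₚ.*-identityˡ _) (cong (p ℕ.+_) (ℕₚ.+-identityʳ p))) ⟩
  (p ℕ.+ v) ⊖ (p ℕ.+ p)                ≡⟨ ℤₚ.+-cancelˡ-⊖ p v p ⟩
  v ⊖ p                                ∎
  where
  open ≡-Reasoning
  p = 2 ^ length ds
  v = valNat ds

m⊖m+1+n : ∀ m n → m ⊖ (m ℕ.+ suc n) ≡ -[1+ n ]
m⊖m+1+n m n = trans (cong (_⊖ (m ℕ.+ suc n)) (sym (ℕₚ.+-identityʳ m))) (ℤₚ.+-cancelˡ-⊖ m 0 (suc n))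

valNat⊖2^[1+length]≤-2 : ∀ {ds} → All (_≤ 1) ds → ∃ λ n → valNat ds ⊖ 2 ^ suc (length ds) ≡ -[1+ suc n ]
valNat⊖2^[1+length]≤-2 {ds} ds≤1 with ℕₚ.m≤n⇒∃[o]m+o≡n v+2≤2p
  where
  v+2≤2p : suc (suc (valNat ds)) ≤ 2 ^ suc (length ds)
  v+2≤2p = begin
    suc (suc (valNat ds))  ≡⟨ ℕₚ.+-comm 1 (suc (valNat ds)) ⟩
    suc (valNat ds) ℕ.+ 1  ≤⟨ ℕₚ.+-mono-≤ (valNat<2^length ds≤1) (ℕₚ.m^n>0 2 (length ds)) ⟩
    p ℕ.+ p                ≡⟨ cong (p ℕ.+_) (sym (ℕₚ.+-identityʳ p)) ⟩
    2 ℕ.* p                ∎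
    where
    open ℕₚ.≤-Reasoning
    p = 2 ^ length ds
... | n , v+2+n≡2p = n , (begin
  v ⊖ 2 ^ suc (length ds)     ≡⟨ cong (v ⊖_) (sym v+2+n≡2p) ⟩
  v ⊖ suc (suc v ℕ.+ n)       ≡⟨ cong (v ⊖_) (sym (trans (ℕₚ.+-suc v (suc n)) (cong suc (ℕₚ.+-suc v n)))) ⟩
  v ⊖ (v ℕ.+ suc (suc n))     ≡⟨ m⊖m+1+n v (suc n) ⟩
  -[1+ suc n ]                ∎)
  where
  open ≡-Reasoning
  v = valNat ds

data Rep2cForm : ℤ → List ℕ → Set where
  zero-word : Rep2cForm (+ 0) (0 ∷ [])
  minus-one : Rep2cForm -[1+ 0 ] (1 ∷ [])
  positive  : ∀ {n} ds → All (_≤ 1) ds → valNat (1 ∷ ds) ≡ suc n →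
              Rep2cForm (+ suc n) (0 ∷ 1 ∷ ds)
  negative  : ∀ {n} ds → All (_≤ 1) ds → valNat ds ⊖ 2 ^ suc (length ds) ≡ -[1+ suc n ] →
              Rep2cForm -[1+ suc n ] (1 ∷ 0 ∷ ds)

rep2c⇔form : ∀ {n w} → Rep2c n w ⇔ Rep2cForm n w
rep2c⇔form = mk⇔ rep2c⇒form form⇒rep2c
  where
  rep2c⇒form : ∀ {n w} → Rep2c n w → Rep2cForm n w
  rep2c⇒form {w = []}                (_ , w≢[] , _)               = ⊥-elim (w≢[] refl)
  rep2c⇒form {w = 0 ∷ []}            (_ , _ , _ , _ , refl)        = zero-word
  rep2c⇒form {w = 1 ∷ []}            (_ , _ , _ , _ , refl)        = minus-one
  rep2c⇒form {w = 0 ∷ 0 ∷ r}         (_ , _ , ¬00 , _)             = ⊥-elim (¬00 r refl)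
  rep2c⇒form {w = 1 ∷ 1 ∷ r}         (_ , _ , _ , ¬11 , _)         = ⊥-elim (¬11 r refl)
  rep2c⇒form {w = 0 ∷ 1 ∷ ds}        ((_ ∷ _ ∷ ds≤1) , _ , _ , _ , refl) =
    let n , v≡1+n = valNat-1∷-nonZero ds in
    subst (λ n → Rep2cForm n (0 ∷ 1 ∷ ds)) (sym (trans (val2c-0∷ (1 ∷ ds)) (cong +_ v≡1+n)))
      (positive ds ds≤1 v≡1+n)
  rep2c⇒form {w = 1 ∷ 0 ∷ ds}        ((_ ∷ _ ∷ ds≤1) , _ , _ , _ , refl) =
    let n , v≡-2-n = valNat⊖2^[1+length]≤-2 ds≤1 in
    subst (λ n → Rep2cForm n (1 ∷ 0 ∷ ds)) (sym (trans (val2c-1∷ (0 ∷ ds)) v≡-2-n))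
      (negative ds ds≤1 v≡-2-n)
  rep2c⇒form {w = 0 ∷ suc (suc _) ∷ _} ((_ ∷ s≤s () ∷ _) , _)
  rep2c⇒form {w = 1 ∷ suc (suc _) ∷ _} ((_ ∷ s≤s () ∷ _) , _)
  rep2c⇒form {w = suc (suc _) ∷ _}     ((s≤s () ∷ _) , _)

  form⇒rep2c : ∀ {n w} → Rep2cForm n w → Rep2c n w
  form⇒rep2c zero-word = (z≤n ∷ []) , (λ ()) , (λ _ ()) , (λ _ ()) , refl
  form⇒rep2c minus-one = (s≤s z≤n ∷ []) , (λ ()) , (λ _ ()) , (λ _ ()) , refl
  form⇒rep2c (positive ds ds≤1 v≡1+n) =
    (z≤n ∷ s≤s z≤n ∷ ds≤1) , (λ ()) , (λ _ ()) , (λ _ ()) ,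
    trans (val2c-0∷ (1 ∷ ds)) (cong +_ v≡1+n)
  form⇒rep2c (negative ds ds≤1 v≡-2-n) =
    (s≤s z≤n ∷ z≤n ∷ ds≤1) , (λ ()) , (λ _ ()) , (λ _ ()) ,
    trans (val2c-1∷ (0 ∷ ds)) v≡-2-n

module _ {s : ℕ} (u : BiSeq s) where

  length-seg : ∀ t ℓ → length (seg u t ℓ) ≡ ℓ
  length-seg t zero    = refl
  length-seg t (suc ℓ) = cong suc (length-seg (t ℤ.+ + 1) ℓ)

  seg-++ : ∀ t a b → seg u t (a ℕ.+ b) ≡ seg u t a ++ seg u (t ℤ.+ + a) b
  seg-++ t zero    b = cong (λ t′ → seg u t′ b) (sym (ℤₚ.+-identityʳ t))
  seg-++ t (suc a) b = cong (u t ∷_) (trans (seg-++ (t ℤ.+ + 1) a b)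
    (cong (λ t′ → seg u (t ℤ.+ + 1) a ++ seg u t′ b) (ℤₚ.+-assoc t (+ 1) (+ a))))

  seg-suc : ∀ t ℓ → seg u t (suc ℓ) ≡ seg u t ℓ ∷ʳ u (t ℤ.+ + ℓ)
  seg-suc t ℓ = trans (cong (seg u t) (ℕₚ.+-comm 1 ℓ)) (seg-++ t ℓ 1)

  seg-prefix : ∀ t {ℓ ℓ′} → ℓ ≤ ℓ′ → Prefix (seg u t ℓ) (seg u t ℓ′)
  seg-prefix t {ℓ} ℓ≤ℓ′ with ℕₚ.m≤n⇒∃[o]m+o≡n ℓ≤ℓ′
  ... | o , refl = seg u (t ℤ.+ + ℓ) o , sym (seg-++ t ℓ o)

  applyW-seg : ∀ {σ : Subst s} {L} → FixedByUniform σ L u →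
               ∀ t ℓ → applyW σ (seg u t ℓ) ≡ seg u (+ L ℤ.* t) (L ℕ.* ℓ)
  applyW-seg {σ} {L} fixed t zero    = cong (seg u (+ L ℤ.* t)) (sym (ℕₚ.*-zeroʳ L))
  applyW-seg {σ} {L} fixed t (suc ℓ) = begin
    σ (u t) ++ applyW σ (seg u (t ℤ.+ + 1) ℓ)
      ≡⟨ cong₂ _++_ (fixed t) (applyW-seg fixed (t ℤ.+ + 1) ℓ) ⟩
    seg u (+ L ℤ.* t) L ++ seg u (+ L ℤ.* (t ℤ.+ + 1)) (L ℕ.* ℓ)
      ≡⟨ cong (λ t′ → seg u (+ L ℤ.* t) L ++ seg u t′ (L ℕ.* ℓ)) next ⟩
    seg u (+ L ℤ.* t) L ++ seg u (+ L ℤ.* t ℤ.+ + L) (L ℕ.* ℓ)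
      ≡⟨ sym (seg-++ (+ L ℤ.* t) L (L ℕ.* ℓ)) ⟩
    seg u (+ L ℤ.* t) (L ℕ.+ L ℕ.* ℓ)
      ≡⟨ cong (seg u (+ L ℤ.* t)) (sym (ℕₚ.*-suc L ℓ)) ⟩
    seg u (+ L ℤ.* t) (L ℕ.* suc ℓ) ∎
    where
    open ≡-Reasoning
    next : + L ℤ.* (t ℤ.+ + 1) ≡ + L ℤ.* t ℤ.+ + L
    next = trans (ℤₚ.*-distribˡ-+ (+ L) t (+ 1)) (cong (λ x → + L ℤ.* t ℤ.+ x) (ℤₚ.*-identityʳ (+ L)))

length-digits : ∀ {s} (m : ℕ → List (Fin s)) k → length (digits m k) ≡ k
length-digits m zero    = refl
length-digits m (suc k) = cong suc (length-digits m k)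

digits-suc : ∀ {s} (m : ℕ → List (Fin s)) k → digits m (suc k) ≡ digits (m ∘ suc) k ∷ʳ length (m 0)
digits-suc m zero    = refl
digits-suc m (suc k) = cong (length (m (suc k)) ∷_) (digits-suc m k)

module _ {s : ℕ} (ψ : Subst s) where

  conc-suc : ∀ (m : ℕ → List (Fin s)) k → conc ψ m (suc k) ≡ applyW ψ (conc ψ (m ∘ suc) k) ++ m 0
  conc-suc m zero    = Listₚ.++-identityʳ (m 0)
  conc-suc m (suc k) = begin
    iterW ψ (suc k) (m (suc k)) ++ conc ψ m (suc k)
      ≡⟨ cong (iterW ψ (suc k) (m (suc k)) ++_) (conc-suc m k) ⟩
    applyW ψ (iterW ψ k (m (suc k))) ++ (applyW ψ (conc ψ (m ∘ suc) k) ++ m 0)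
      ≡⟨ sym (Listₚ.++-assoc (applyW ψ (iterW ψ k (m (suc k)))) _ (m 0)) ⟩
    (applyW ψ (iterW ψ k (m (suc k))) ++ applyW ψ (conc ψ (m ∘ suc) k)) ++ m 0
      ≡⟨ cong (_++ m 0) (sym (Listₚ.concatMap-++ ψ (iterW ψ k (m (suc k))) (conc ψ (m ∘ suc) k))) ⟩
    applyW ψ (conc ψ (m ∘ suc) (suc k)) ++ m 0 ∎
    where open ≡-Reasoning

  chain⇒admissible : ∀ {x k m a} → (∀ i → i < k → Prefix (m i ∷ʳ a i) (ψ (a (suc i)))) →
                     a k ≡ x → Admissible ψ x k m a
  chain⇒admissible {m = m} {a} chain a[k]≡x =
    (λ i 1+i<k → chain i (ℕₚ.<⇒≤ 1+i<k)) ,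
    (λ i 1+i≡k → subst (λ z → Prefix (m i ∷ʳ a i) (ψ z)) (trans (cong a 1+i≡k) a[k]≡x)
                   (chain i (ℕₚ.≤-reflexive 1+i≡k)))

  module _ (two : TwoUniform ψ) where

    length-applyW : ∀ w → length (applyW ψ w) ≡ 2 ℕ.* length w
    length-applyW []      = refl
    length-applyW (x ∷ w) = trans (Listₚ.length-++ (ψ x))
      (trans (cong₂ ℕ._+_ (two x) (length-applyW w)) (sym (ℕₚ.*-suc 2 (length w))))

    length-iterW : ∀ k w → length (iterW ψ k w) ≡ 2 ^ k ℕ.* length w
    length-iterW zero    w = sym (ℕₚ.*-identityˡ (length w))
    length-iterW (suc k) w = trans (length-applyW (iterW ψ k w))
      (trans (cong (2 ℕ.*_) (length-iterW k w)) (sym (ℕₚ.*-assoc 2 (2 ^ k) (length w))))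

    length-conc : ∀ m k → length (conc ψ m k) ≡ valNat (digits m k)
    length-conc m zero    = refl
    length-conc m (suc k) = trans (Listₚ.length-++ (iterW ψ k (m k)))
      (cong₂ ℕ._+_ top (length-conc m k))
      where
      top : length (iterW ψ k (m k)) ≡ length (m k) ℕ.* 2 ^ length (digits m k)
      top = trans (length-iterW k (m k))
        (trans (ℕₚ.*-comm (2 ^ k) _) (cong (λ j → length (m k) ℕ.* 2 ^ j) (sym (length-digits m k))))

    admissible-digits≤1 : ∀ {x k m a} → Admissible ψ x k m a → All (_≤ 1) (digits m k)
    admissible-digits≤1 {k = k} {m} {a} (chain , top) = go k ℕₚ.≤-refl
      where
      digit≤1 : ∀ {xs y z} → Prefix (xs ∷ʳ y) (ψ z) → length xs ≤ 1
      digit≤1 {xs} {y} {z} p = ℕ.s≤s⁻¹ (subst₂ _≤_ (length-∷ʳ xs y) (two z) (prefix-length≤ p))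
      go : ∀ j → j ≤ k → All (_≤ 1) (digits m j)
      go zero    _   = []
      go (suc j) j<k with ℕₚ.m≤n⇒m<n∨m≡n j<k
      ... | inj₁ 1+j<k = digit≤1 (chain j 1+j<k) ∷ go j (ℕₚ.<⇒≤ j<k)
      ... | inj₂ 1+j≡k = digit≤1 (top j 1+j≡k) ∷ go j (ℕₚ.<⇒≤ j<k)

module Construction {s : ℕ} (ψ : Subst s) (β : BiSeq s) (fixed : FixedByUniform ψ 2 β) where

  -- Digit lists rs are read least significant digit first; position Q rs is the index
  -- of the letter reached from β Q after the digits rs.
  position : ℤ → List ℕ → ℤ
  position Q []       = Q
  position Q (r ∷ rs) = + 2 ℤ.* position Q rs ℤ.+ + r

  blocks : ℤ → List ℕ → ℕ → List (Fin s)
  blocks Q []       i       = []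
  blocks Q (r ∷ rs) zero    = seg β (+ 2 ℤ.* position Q rs) r
  blocks Q (r ∷ rs) (suc i) = blocks Q rs i

  letters : ℤ → List ℕ → ℕ → Fin s
  letters Q []       i       = β Q
  letters Q (r ∷ rs) zero    = β (position Q (r ∷ rs))
  letters Q (r ∷ rs) (suc i) = letters Q rs i

  letters-zero : ∀ Q rs → letters Q rs 0 ≡ β (position Q rs)
  letters-zero Q []       = refl
  letters-zero Q (r ∷ rs) = refl

  letters-top : ∀ Q rs → letters Q rs (length rs) ≡ β Q
  letters-top Q []       = refl
  letters-top Q (r ∷ rs) = letters-top Q rs

  blocks-chain : ∀ Q {rs} → All (_≤ 1) rs → ∀ i → i < length rs →
                 Prefix (blocks Q rs i ∷ʳ letters Q rs i) (ψ (letters Q rs (suc i)))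
  blocks-chain Q {r ∷ rs} (r≤1 ∷ _) zero _ =
    subst₂ Prefix (seg-suc β (+ 2 ℤ.* P) r) (sym (trans (cong ψ (letters-zero Q rs)) (fixed P)))
      (seg-prefix β (+ 2 ℤ.* P) (s≤s r≤1))
    where P = position Q rs
  blocks-chain Q {r ∷ rs} (_ ∷ rs≤1) (suc i) (s≤s i<k) = blocks-chain Q rs≤1 i i<k

  position-≡ : ∀ Q rs → position Q rs ≡ + (2 ^ length rs) ℤ.* Q ℤ.+ + valNat (reverse rs)
  position-≡ Q []       = sym (trans (ℤₚ.+-identityʳ _) (ℤₚ.*-identityˡ Q))
  position-≡ Q (r ∷ rs) = begin
    + 2 ℤ.* position Q rs ℤ.+ + r
      ≡⟨ cong (λ p → + 2 ℤ.* p ℤ.+ + r) (position-≡ Q rs) ⟩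
    + 2 ℤ.* (A ℤ.* Q ℤ.+ + V) ℤ.+ + r
      ≡⟨ regroup A Q (+ V) (+ r) ⟩
    (+ 2 ℤ.* A) ℤ.* Q ℤ.+ (+ 2 ℤ.* + V ℤ.+ + r)
      ≡⟨ sym (cong₂ (λ a v → a ℤ.* Q ℤ.+ v) (ℤₚ.pos-* 2 (2 ^ length rs))
               (trans (ℤₚ.pos-+ (2 ℕ.* V) r) (cong (ℤ._+ + r) (ℤₚ.pos-* 2 V)))) ⟩
    + (2 ^ suc (length rs)) ℤ.* Q ℤ.+ + (2 ℕ.* V ℕ.+ r)
      ≡⟨ cong (λ v → + (2 ^ suc (length rs)) ℤ.* Q ℤ.+ + v) (sym (valNat-reverse-∷ r rs)) ⟩
    + (2 ^ length (r ∷ rs)) ℤ.* Q ℤ.+ + valNat (reverse (r ∷ rs)) ∎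
    where
    open ≡-Reasoning
    A = + (2 ^ length rs)
    V = valNat (reverse rs)
    regroup : ∀ A Q V r → + 2 ℤ.* (A ℤ.* Q ℤ.+ V) ℤ.+ r ≡ (+ 2 ℤ.* A) ℤ.* Q ℤ.+ (+ 2 ℤ.* V ℤ.+ r)
    regroup = ℤSolver.solve-∀

  blocks-conc : ∀ Q rs → seg β (+ (2 ^ length rs) ℤ.* Q) (valNat (reverse rs)) ≡
                         conc ψ (blocks Q rs) (length rs)
  blocks-conc Q []       = refl
  blocks-conc Q (r ∷ rs) = begin
    seg β (+ (2 ^ suc k) ℤ.* Q) (valNat (reverse (r ∷ rs)))
      ≡⟨ cong₂ (seg β) double (valNat-reverse-∷ r rs) ⟩
    seg β (+ 2 ℤ.* X) (2 ℕ.* V ℕ.+ r)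
      ≡⟨ seg-++ β (+ 2 ℤ.* X) (2 ℕ.* V) r ⟩
    seg β (+ 2 ℤ.* X) (2 ℕ.* V) ++ seg β (+ 2 ℤ.* X ℤ.+ + (2 ℕ.* V)) r
      ≡⟨ cong₂ _++_ (sym (applyW-seg β fixed X V)) (cong (λ t → seg β t r) end) ⟩
    applyW ψ (seg β X V) ++ blocks Q (r ∷ rs) 0
      ≡⟨ cong (λ w → applyW ψ w ++ blocks Q (r ∷ rs) 0) (blocks-conc Q rs) ⟩
    applyW ψ (conc ψ (blocks Q rs) k) ++ blocks Q (r ∷ rs) 0
      ≡⟨ sym (conc-suc ψ (blocks Q (r ∷ rs)) k) ⟩
    conc ψ (blocks Q (r ∷ rs)) (suc k) ∎
    where
    open ≡-Reasoning
    k = length rs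
    X = + (2 ^ k) ℤ.* Q
    V = valNat (reverse rs)
    double : + (2 ^ suc k) ℤ.* Q ≡ + 2 ℤ.* X
    double = trans (cong (ℤ._* Q) (ℤₚ.pos-* 2 (2 ^ k))) (ℤₚ.*-assoc (+ 2) (+ (2 ^ k)) Q)
    end : + 2 ℤ.* X ℤ.+ + (2 ℕ.* V) ≡ + 2 ℤ.* position Q rs
    end = begin
      + 2 ℤ.* X ℤ.+ + (2 ℕ.* V)     ≡⟨ cong (λ v → + 2 ℤ.* X ℤ.+ v) (ℤₚ.pos-* 2 V) ⟩
      + 2 ℤ.* X ℤ.+ + 2 ℤ.* + V     ≡⟨ sym (ℤₚ.*-distribˡ-+ (+ 2) X (+ V)) ⟩
      + 2 ℤ.* (X ℤ.+ + V)           ≡⟨ cong (λ p → + 2 ℤ.* p) (sym (position-≡ Q rs)) ⟩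
      + 2 ℤ.* position Q rs         ∎

  blocks-digits : ∀ Q rs → digits (blocks Q rs) (length rs) ≡ reverse rs
  blocks-digits Q []       = refl
  blocks-digits Q (r ∷ rs) = begin
    digits (blocks Q (r ∷ rs)) (suc (length rs))
      ≡⟨ digits-suc (blocks Q (r ∷ rs)) (length rs) ⟩
    digits (blocks Q rs) (length rs) ∷ʳ length (seg β (+ 2 ℤ.* position Q rs) r)
      ≡⟨ cong₂ _∷ʳ_ (blocks-digits Q rs) (length-seg β _ r) ⟩
    reverse rs ∷ʳ r
      ≡⟨ sym (Listₚ.unfold-reverse r rs) ⟩
    reverse (r ∷ rs) ∎
    where open ≡-Reasoning

  Expansion : ℤ → ℕ → List ℕ → Set
  Expansion Q k ds = Σ (ℕ → List (Fin s)) λ m → Σ (ℕ → Fin s) λ a →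
    Admissible ψ (β Q) k m a × seg β (+ (2 ^ k) ℤ.* Q) (valNat ds) ≡ conc ψ m k × digits m k ≡ ds

  expansion : ∀ Q {ds} → All (_≤ 1) ds → Expansion Q (length ds) ds
  expansion Q {ds} ds≤1 =
    subst₂ (Expansion Q) (Listₚ.length-reverse ds) (Listₚ.reverse-involutive ds)
      (expansion-reverse (reverse ds) (All-reverse ds≤1))
    where
    expansion-reverse : ∀ rs → All (_≤ 1) rs → Expansion Q (length rs) (reverse rs)
    expansion-reverse rs rs≤1 =
      blocks Q rs , letters Q rs ,
      chain⇒admissible ψ (blocks-chain Q rs≤1) (letters-top Q rs) ,
      blocks-conc Q rs , blocks-digits Q rs

module _ {s : ℕ} (ψ : Subst s) (u : BiSeq s) where

  -- The conditions of RepDT for p = 1 and k = J + 1, with the block m_{k-p} ⋯ m_{k-1} read as m_J.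
  DTWitness⁺ : ℕ → List ℕ → (ℕ → List (Fin s)) → (ℕ → Fin s) → ℕ → Set
  DTWitness⁺ n w m a J =
    Admissible ψ (u (+ 0)) (suc J) m a × m J ≢ [] ×
    seg u (+ 0) (suc n) ≡ conc ψ m (suc J) × w ≡ 0 ∷ digits m (suc J)

  DTWitness⁻ : ℕ → List ℕ → (ℕ → List (Fin s)) → (ℕ → Fin s) → ℕ → Set
  DTWitness⁻ n w m a J =
    Admissible ψ (u -[1+ 0 ]) (suc J) m a × m J ∷ʳ a J ≢ ψ (u -[1+ 0 ]) ×
    (∃ λ ℓ → - (+ L) ℤ.+ + ℓ ≡ -[1+ suc n ] × seg u (- (+ L)) ℓ ≡ conc ψ m (suc J)) ×
    w ≡ 1 ∷ digits m (suc J)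
    where L = length (iterW ψ (suc J) (u -[1+ 0 ] ∷ []))

  RepDT₁⁺ RepDT₁⁻ : ℕ → List ℕ → Set
  RepDT₁⁺ n w = ∃ λ J → Σ (ℕ → List (Fin s)) λ m → Σ (ℕ → Fin s) λ a → DTWitness⁺ n w m a J
  RepDT₁⁻ n w = ∃ λ J → Σ (ℕ → List (Fin s)) λ m → Σ (ℕ → Fin s) λ a → DTWitness⁻ n w m a J

  private
    top-block : ∀ (m : ℕ → List (Fin s)) J → m (J ℕ.+ 0) ++ [] ≡ m J
    top-block m J = trans (Listₚ.++-identityʳ _) (cong m (ℕₚ.+-identityʳ J))

  repDT₁⁺ : ∀ {n w} → RepDT ψ u 1 (+ suc n) w ⇔ RepDT₁⁺ n w
  repDT₁⁺ = mk⇔ elim intro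
    where
    elim : ∀ {n w} → RepDT ψ u 1 (+ suc n) w → RepDT₁⁺ n w
    elim (j , m , a , adm , top≢[] , sg , w≡) =
      j ℕ.+ 0 , m , a , adm , top≢[] ∘ trans (top-block m _) , sg , w≡
    intro : ∀ {n w} → RepDT₁⁺ n w → RepDT ψ u 1 (+ suc n) w
    intro {n} {w} (J , m , a , witness)
      with adm , mJ≢[] , sg , w≡ ← subst (DTWitness⁺ n w m a) (sym (ℕₚ.+-identityʳ J)) witness =
      J , m , a , adm , mJ≢[] ∘ trans (sym (top-block m _)) , sg , w≡

  repDT₁⁻ : ∀ {n w} → RepDT ψ u 1 -[1+ suc n ] w ⇔ RepDT₁⁻ n w
  repDT₁⁻ = mk⇔ elim intro
    where
    elim : ∀ {n w} → RepDT ψ u 1 -[1+ suc n ] w → RepDT₁⁻ n w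
    elim (j , m , a , adm , notFull , lower , w≡) =
      j ℕ.+ 0 , m , a , adm ,
      (λ full → notFull (trans (cong (_∷ʳ a _) (top-block m _)) (trans full (sym (Listₚ.++-identityʳ _))))) ,
      lower , w≡
    intro : ∀ {n w} → RepDT₁⁻ n w → RepDT ψ u 1 -[1+ suc n ] w
    intro {n} {w} (J , m , a , witness)
      with adm , notFull , lower , w≡ ← subst (DTWitness⁻ n w m a) (sym (ℕₚ.+-identityʳ J)) witness =
      J , m , a , adm ,
      (λ full → notFull (trans (cong (_∷ʳ a _) (sym (top-block m _))) (trans full (Listₚ.++-identityʳ _)))) ,
      lower , w≡

module _ {s : ℕ} {ψ : Subst s} (two : TwoUniform ψ) {β : BiSeq s} (fixed : FixedByUniform ψ 2 β) where

  open Construction ψ β fixed using (expansion)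

  length-iterW-[_] : ∀ k x → length (iterW ψ k (x ∷ [])) ≡ 2 ^ k
  length-iterW-[ k ] x = trans (length-iterW ψ two k (x ∷ [])) (ℕₚ.*-identityʳ (2 ^ k))

  repDT₁⁺⇒form : ∀ {n w} → RepDT₁⁺ ψ β n w → Rep2cForm (+ suc n) w
  repDT₁⁺⇒form {n} (J , m , a , adm , mJ≢[] , sg , refl)
    with top≤1 ∷ ds≤1 ← admissible-digits≤1 ψ two adm =
    subst (λ d → Rep2cForm (+ suc n) (0 ∷ d ∷ digits m J)) (sym top≡1)
      (positive (digits m J) ds≤1 value)
    where
    top≡1 : length (m J) ≡ 1
    top≡1 = [ (λ mJ≡[] → ⊥-elim (mJ≢[] mJ≡[])) , id ]′ (length≤1 top≤1)
    value : valNat (1 ∷ digits m J) ≡ suc n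
    value = begin
      valNat (1 ∷ digits m J)                 ≡⟨ cong (λ d → valNat (d ∷ digits m J)) (sym top≡1) ⟩
      valNat (digits m (suc J))               ≡⟨ sym (length-conc ψ two m (suc J)) ⟩
      length (conc ψ m (suc J))               ≡⟨ cong length (sym sg) ⟩
      length (seg β (+ 0) (suc n))            ≡⟨ length-seg β (+ 0) (suc n) ⟩
      suc n                                   ∎
      where open ≡-Reasoning

  repDT₁⁻⇒form : ∀ {n w} → RepDT₁⁻ ψ β n w → Rep2cForm -[1+ suc n ] w
  repDT₁⁻⇒form {n} (J , m , a , adm , notFull , (ℓ , ℓ-eq , sg) , refl)
    with top≤1 ∷ ds≤1 ← admissible-digits≤1 ψ two adm =
    subst (λ d → Rep2cForm -[1+ suc n ] (1 ∷ d ∷ ds)) (sym (cong length mJ≡[]))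
      (negative ds ds≤1 value)
    where
    ds = digits m J
    full : length (m J) ≡ 1 → m J ∷ʳ a J ≡ ψ (β -[1+ 0 ])
    full mJ≡1 = prefix-length≡ (proj₂ adm J refl)
      (trans (length-∷ʳ (m J) (a J)) (trans (cong suc mJ≡1) (sym (two _))))
    mJ≡[] : m J ≡ []
    mJ≡[] = [ id , (λ mJ≡1 → ⊥-elim (notFull (full mJ≡1))) ]′ (length≤1 top≤1)
    ℓ≡v : ℓ ≡ valNat ds
    ℓ≡v = begin
      ℓ                                 ≡⟨ sym (length-seg β _ ℓ) ⟩
      length (seg β _ ℓ)                ≡⟨ cong length sg ⟩
      length (conc ψ m (suc J))         ≡⟨ length-conc ψ two m (suc J) ⟩
      valNat (length (m J) ∷ ds)        ≡⟨ cong (λ d → valNat (d ∷ ds)) (cong length mJ≡[]) ⟩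
      valNat ds                         ∎
      where open ≡-Reasoning
    value : valNat ds ⊖ 2 ^ suc (length ds) ≡ -[1+ suc n ]
    value = begin
      valNat ds ⊖ 2 ^ suc (length ds)
        ≡⟨ cong₂ (λ v k → v ⊖ 2 ^ suc k) (sym ℓ≡v) (length-digits m J) ⟩
      ℓ ⊖ 2 ^ suc J
        ≡⟨ cong (ℓ ⊖_) (sym (length-iterW-[ suc J ] (β -[1+ 0 ]))) ⟩
      ℓ ⊖ length (iterW ψ (suc J) (β -[1+ 0 ] ∷ []))
        ≡⟨ sym (ℤₚ.-m+n≡n⊖m (length (iterW ψ (suc J) (β -[1+ 0 ] ∷ []))) ℓ) ⟩
      - (+ length (iterW ψ (suc J) (β -[1+ 0 ] ∷ []))) ℤ.+ + ℓ
        ≡⟨ ℓ-eq ⟩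
      -[1+ suc n ] ∎
      where open ≡-Reasoning

  form⇒repDT₁⁺ : ∀ {n} ds → All (_≤ 1) ds → valNat (1 ∷ ds) ≡ suc n → RepDT₁⁺ ψ β n (0 ∷ 1 ∷ ds)
  form⇒repDT₁⁺ {n} ds ds≤1 v≡1+n with m , a , adm , sg , dg ← expansion (+ 0) (s≤s z≤n ∷ ds≤1) =
    length ds , m , a , adm , mJ≢[] , sg′ , cong (0 ∷_) (sym dg)
    where
    mJ≢[] : m (length ds) ≢ []
    mJ≢[] mJ≡[] = ℕₚ.1+n≢0 (trans (sym (Listₚ.∷-injectiveˡ dg)) (cong length mJ≡[]))
    sg′ : seg β (+ 0) (suc n) ≡ conc ψ m (suc (length ds))
    sg′ = trans (cong₂ (seg β) (sym (ℤₚ.*-zeroʳ (+ (2 ^ suc (length ds))))) (sym v≡1+n)) sg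

  form⇒repDT₁⁻ : ∀ {n} ds → All (_≤ 1) ds → valNat ds ⊖ 2 ^ suc (length ds) ≡ -[1+ suc n ] →
                 RepDT₁⁻ ψ β n (1 ∷ 0 ∷ ds)
  form⇒repDT₁⁻ {n} ds ds≤1 v≡-2-n with m , a , adm , sg , dg ← expansion -[1+ 0 ] (z≤n ∷ ds≤1) =
    k , m , a , adm , notFull , (valNat ds , ℓ-eq , sg′) , cong (1 ∷_) (sym dg)
    where
    k = length ds
    L = length (iterW ψ (suc k) (β -[1+ 0 ] ∷ []))
    notFull : m k ∷ʳ a k ≢ ψ (β -[1+ 0 ])
    notFull full = ℕₚ.0≢1+n (trans (sym (Listₚ.∷-injectiveˡ dg)) (ℕₚ.suc-injective (begin
      suc (length (m k))         ≡⟨ sym (length-∷ʳ (m k) (a k)) ⟩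
      length (m k ∷ʳ a k)        ≡⟨ cong length full ⟩
      length (ψ (β -[1+ 0 ]))    ≡⟨ two _ ⟩
      2                          ∎)))
      where open ≡-Reasoning
    ℓ-eq : - (+ L) ℤ.+ + valNat ds ≡ -[1+ suc n ]
    ℓ-eq = trans (ℤₚ.-m+n≡n⊖m L (valNat ds))
             (trans (cong (valNat ds ⊖_) (length-iterW-[ suc k ] (β -[1+ 0 ]))) v≡-2-n)
    sg′ : seg β (- (+ L)) (valNat ds) ≡ conc ψ m (suc k)
    sg′ = trans (cong (λ t → seg β t (valNat ds)) position) sg
      where
      position : - (+ L) ≡ + (2 ^ suc k) ℤ.* -[1+ 0 ]
      position = trans (cong (λ k → - (+ k)) (length-iterW-[ suc k ] (β -[1+ 0 ])))
                   (sym (trans (ℤₚ.*-comm (+ (2 ^ suc k)) -[1+ 0 ]) (ℤₚ.-1*i≡-i _)))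

  repDT⇔form : ∀ {n w} → RepDT ψ β 1 n w ⇔ Rep2cForm n w
  repDT⇔form = mk⇔ repDT⇒form form⇒repDT
    where
    repDT⇒form : ∀ {n w} → RepDT ψ β 1 n w → Rep2cForm n w
    repDT⇒form {+ zero}       refl = zero-word
    repDT⇒form { -[1+ zero ]} refl = minus-one
    repDT⇒form {+ suc n}      r    = repDT₁⁺⇒form (to (repDT₁⁺ ψ β) r)
    repDT⇒form { -[1+ suc n ]} r   = repDT₁⁻⇒form (to (repDT₁⁻ ψ β) r)

    form⇒repDT : ∀ {n w} → Rep2cForm n w → RepDT ψ β 1 n w
    form⇒repDT zero-word                  = refl
    form⇒repDT minus-one                  = refl
    form⇒repDT (positive ds ds≤1 v≡1+n)   = from (repDT₁⁺ ψ β) (form⇒repDT₁⁺ ds ds≤1 v≡1+n)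
    form⇒repDT (negative ds ds≤1 v≡-2-n)  = from (repDT₁⁻ ψ β) (form⇒repDT₁⁻ ds ds≤1 v≡-2-n)

proposition23 : (s : ℕ) (ψ : Subst s) → TwoUniform ψ →
    (β : BiSeq s) → IsPeriodicPoint ψ β 1 →
    (n : ℤ) (w : List ℕ) → RepDT ψ β 1 n w ⇔ Rep2c n w
proposition23 s ψ two β (_ , fixedByψ¹ , _) n w =
  ⇔.trans (repDT⇔form two fixed) (⇔.sym rep2c⇔form)
  where
  fixed : FixedByUniform ψ 2 β
  fixed i = trans (sym (Listₚ.++-identityʳ (ψ (β i)))) (fixedByψ¹ i)
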